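{- Let $n\ge5$ and let $w=w_1\cdots w_n\in S_n$ satisfy $Q(w)=\widehat Q$. Then: (1) either $w_n=1$ or $w_3=1$; (2) if $w_3=1$, then $w_1=2$, $w_4=2$, or $w_n=2$; (3) if $w_3=1$ and $w_1=2$, then $w_4=3$ or $w_n=3$.
   Context: For $n\ge5$, $\widehat Q$ is the standard tableau of shape $(n-3,2,1)$ (English notation) whose first row is $1,2,5,6,\dots,n-1$, second row is $3,4$, and third row is $n$. $Q(w)$ denotes the Robinson–Schensted recording tableau of $w$. -}

module Defs where

open import Data.Nat using (ℕ; zero; suc; _+_; _∸_; _<ᵇ_)
open import Data.Bool using (true; false)
open import Data.List using (List; []; _∷_; [_]; map; upTo; _++_)
open import Data.Maybe using (Maybe; just; nothing)
open import Data.Product using (_×_; _,_)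
open import Data.List.Relation.Binary.Permutation.Propositional using (_↭_)

-- A tableau is a list of rows (English notation, first row on top).
Tableau : Set
Tableau = List (List ℕ)

rowIns : ℕ → List ℕ → List ℕ × Maybe ℕ
rowIns x [] = [ x ] , nothing
rowIns x (y ∷ ys) with x <ᵇ y
... | true = x ∷ ys , just y
... | false with rowIns x ys
...   | r , b = y ∷ r , b

-- Insert x into a tableau; also return the (0-based) index of the row that grew.
ins : ℕ → Tableau → Tableau × ℕ
ins x [] = [ x ] ∷ [] , 0
ins x (r ∷ rs) with rowIns x r
... | r' , nothing = r' ∷ rs , 0
... | r' , just y with ins y rs
...   | rs' , k = r' ∷ rs' , suc k

addAt : ℕ → ℕ → Tableau → Tableau
addAt v zero [] = [ v ] ∷ []
addAt v (suc k) [] = [ v ] ∷ []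
addAt v zero (r ∷ rs) = (r ++ [ v ]) ∷ rs
addAt v (suc k) (r ∷ rs) = r ∷ addAt v k rs

rsAux : ℕ → List ℕ → Tableau → Tableau → Tableau × Tableau
rsAux i [] P Q = P , Q
rsAux i (x ∷ xs) P Q with ins x P
... | P' , k = rsAux (suc i) xs P' (addAt i k Q)

recQ : List ℕ → Tableau
recQ w with rsAux 1 w [] []
... | _ , Q = Q

-- w ∈ S_n in one-line notation: a word that is a rearrangement of 1,…,n
-- (this forces length n).
IsPerm : (n : ℕ) → List ℕ → Set
IsPerm n w = w ↭ map suc (upTo n)

-- 1-based letter w_i of a word (0 if out of range; never used out of range below).
_at_ : List ℕ → ℕ → ℕ
[] at i = 0
(x ∷ xs) at zero = 0
(x ∷ xs) at suc zero = x
(x ∷ xs) at suc (suc i) = xs at suc i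

Qhat : ℕ → Tableau
Qhat n = (1 ∷ 2 ∷ map (5 +_) (upTo (n ∸ 5))) ∷ (3 ∷ 4 ∷ []) ∷ (n ∷ []) ∷ []

{-# OPTIONS --safe #-}
module Submission where

-- Rows of the recording tableau only grow, so Q(w₁w₂w₃w₄) must be 1 2 / 3 4; tracing the
-- insertions shows this forces w₃ < w₁ < w₂ and w₃ < w₄ < w₂, with insertion tableau
-- w₃ w₄ / w₁ w₂. Each of w₅, …, wₙ₋₁ is then recorded in the first row, so it bumps nothing
-- and exceeds w₄. Thus every letter is w₁, w₃, w₄, wₙ or larger than w₄, and locating the
-- letters 1, 2, 3 among these gives the three claims.

open import Defs
open import Data.Nat using (ℕ; zero; suc; _+_; _<ᵇ_; _≤_; _<_; z≤n; s≤s; z<s; s<s)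
open import Data.Nat.Properties
open import Data.Bool using (true; false; T)
open import Data.Bool.Properties using (T-≡)
open import Function.Bundles using (Equivalence)
open import Data.List using (List; []; _∷_; [_]; map; upTo; _++_; length)
open import Data.Maybe using (just; nothing)
open import Data.Product using (_×_; _,_; proj₁; proj₂)
open import Data.Sum using (_⊎_; inj₁; inj₂)
open import Data.Empty using (⊥; ⊥-elim)
open import Relation.Binary.PropositionalEquality using (_≡_; _≢_; refl; sym; trans; cong; subst)
open import Relation.Binary.Structures using (IsPreorder)
import Relation.Binary.PropositionalEquality.Properties as ≡
open import Data.List.Relation.Unary.All as All using (All; []; _∷_)
open import Data.List.Relation.Unary.Any using (here; there)
open import Data.List.Relation.Unary.AllPairs using (_∷_)
open import Data.List.Relation.Unary.Unique.Propositional using (Unique)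
import Data.List.Relation.Unary.Unique.Propositional.Properties as Unique
open import Data.List.Membership.Propositional using (_∈_)
open import Data.List.Membership.Propositional.Properties using (∈-++⁺ˡ; ∈-map⁺; ∈-map⁻; ∈-upTo⁺)
open import Data.List.Properties using (length-map; length-upTo)
open import Data.List.Relation.Binary.Prefix.Heterogeneous using (Prefix; []; _∷_; _++ᵖ_)
open import Data.List.Relation.Binary.Prefix.Homogeneous.Properties using () renaming (isPreorder to prefix-isPreorder)
open import Data.List.Relation.Binary.Permutation.Propositional using (↭-sym; ↭⇒↭ₛ)
open import Data.List.Relation.Binary.Permutation.Propositional.Properties using (∈-resp-↭; ↭-length)
open import Data.List.Relation.Binary.Permutation.Setoid.Properties (≡.setoid ℕ) using (Unique-resp-↭)

<ᵇ-true⇒< : ∀ {x y} → (x <ᵇ y) ≡ true → x < y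
<ᵇ-true⇒< e = <ᵇ⇒< _ _ (Equivalence.from T-≡ e)

<ᵇ-true : ∀ {x y} → x < y → (x <ᵇ y) ≡ true
<ᵇ-true x<y = Equivalence.to T-≡ (<⇒<ᵇ x<y)

<ᵇ-false⇒≥ : ∀ {x y} → (x <ᵇ y) ≡ false → y ≤ x
<ᵇ-false⇒≥ e = ≮⇒≥ (λ x<y → subst T e (<⇒<ᵇ x<y))

<ᵇ-false : ∀ {x y} → y ≤ x → (x <ᵇ y) ≡ false
<ᵇ-false {x} {y} y≤x with x <ᵇ y in e
... | false = refl
... | true = ⊥-elim (≤⇒≯ y≤x (<ᵇ-true⇒< e))

IsPerm-length : ∀ {n w} → IsPerm n w → length w ≡ n
IsPerm-length {n} perm = trans (↭-length perm) (trans (length-map suc (upTo n)) (length-upTo n))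

IsPerm-unique : ∀ {n w} → IsPerm n w → Unique w
IsPerm-unique {n} perm = Unique-resp-↭ (↭⇒↭ₛ (↭-sym perm)) (Unique.map⁺ suc-injective (Unique.upTo⁺ n))

IsPerm-positive : ∀ {n w v} → IsPerm n w → v ∈ w → 1 ≤ v
IsPerm-positive perm v∈w with ∈-map⁻ suc (∈-resp-↭ perm v∈w)
... | _ , _ , refl = s≤s z≤n

IsPerm-∋ : ∀ {n w u} → IsPerm n w → u < n → suc u ∈ w
IsPerm-∋ perm u<n = ∈-resp-↭ (↭-sym perm) (∈-map⁺ suc (∈-upTo⁺ u<n))

infix 4 _⊑_

_⊑_ : Tableau → Tableau → Set
_⊑_ = Prefix (Prefix _≡_)

private
  module Row = IsPreorder (prefix-isPreorder (≡.isPreorder {A = ℕ}))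
  module ⊑ = IsPreorder (prefix-isPreorder (prefix-isPreorder (≡.isPreorder {A = ℕ})))

⊑-addAt : ∀ v k Q → Q ⊑ addAt v k Q
⊑-addAt v zero [] = []
⊑-addAt v (suc k) [] = []
⊑-addAt v zero (r ∷ Q) = (Row.refl ++ᵖ [ v ]) ∷ ⊑.refl
⊑-addAt v (suc k) (r ∷ Q) = Row.refl ∷ ⊑-addAt v k Q

recQFrom : ℕ → List ℕ → Tableau → Tableau → Tableau
recQFrom i xs P Q = proj₂ (rsAux i xs P Q)

⊑-recQFrom : ∀ i xs P Q → Q ⊑ recQFrom i xs P Q
⊑-recQFrom i [] P Q = ⊑.refl
⊑-recQFrom i (x ∷ xs) P Q with ins x P
... | P′ , k = ⊑.trans (⊑-addAt i k Q) (⊑-recQFrom (suc i) xs P′ (addAt i k Q))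

rowIns-unbumped : ∀ x r {r′} → rowIns x r ≡ (r′ , nothing) → r′ ≡ r ++ [ x ] × All (_≤ x) r
rowIns-unbumped x [] refl = refl , []
rowIns-unbumped x (y ∷ ys) eq with x <ᵇ y in x<ᵇy
rowIns-unbumped x (y ∷ ys) () | true
... | false with rowIns x ys in ins-ys
...   | r , nothing with refl ← eq =
  let r≡ , ys≤x = rowIns-unbumped x ys ins-ys in cong (y ∷_) r≡ , <ᵇ-false⇒≥ x<ᵇy ∷ ys≤x
...   | r , just _ with () ← eq

lowerRow-⋢Qhat : ∀ {n i} q₁ k → i < n → addAt i (suc k) (q₁ ∷ (3 ∷ 4 ∷ []) ∷ []) ⊑ Qhat n → ⊥
lowerRow-⋢Qhat q₁ zero i<n (_ ∷ (_ ∷ _ ∷ ()) ∷ _)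
lowerRow-⋢Qhat q₁ (suc zero) i<n (_ ∷ _ ∷ (i≡n ∷ _) ∷ _) = <-irrefl i≡n i<n
lowerRow-⋢Qhat q₁ (suc (suc k)) i<n (_ ∷ _ ∷ (i≡n ∷ _) ∷ _) = <-irrefl i≡n i<n

tail-above-firstRow : ∀ {n} i xs R rs q₁ {u} → u ∈ R → i + length xs ≡ suc n →
  recQFrom i xs (R ∷ rs) (q₁ ∷ (3 ∷ 4 ∷ []) ∷ []) ≡ Qhat n →
  ∀ {v} → v ∈ xs → u ≤ v ⊎ v ≡ xs at length xs
tail-above-firstRow i (x ∷ []) R rs q₁ u∈R len hq (here refl) = inj₂ refl
tail-above-firstRow i (x ∷ y ∷ ys) R rs q₁ u∈R len hq v∈xs with rowIns x R in ins-x
... | R′ , nothing with rowIns-unbumped x R ins-x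
...   | refl , R≤x with v∈xs
...     | here refl = inj₁ (All.lookup R≤x u∈R)
...     | there v∈ys = tail-above-firstRow (suc i) (y ∷ ys) (R ++ [ x ]) rs (q₁ ++ [ i ])
                         (∈-++⁺ˡ u∈R) (trans (sym (+-suc i _)) len) hq v∈ys
tail-above-firstRow i (x ∷ y ∷ ys) R rs q₁ u∈R len hq v∈xs | R′ , just z with ins z rs
... | rs′ , k = ⊥-elim (lowerRow-⋢Qhat q₁ k i<n
      (subst (Q′ ⊑_) hq (⊑-recQFrom (suc i) (y ∷ ys) (R′ ∷ rs′) Q′)))
  where
  Q′ : Tableau
  Q′ = addAt i (suc k) (q₁ ∷ (3 ∷ 4 ∷ []) ∷ [])
  i<n : i < _
  i<n = subst (i <_) (suc-injective (trans (sym (+-suc i _)) len)) (m<m+n i z<s)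

rs₄ : ℕ → ℕ → ℕ → ℕ → Tableau × Tableau
rs₄ a b c d = rsAux 1 (a ∷ b ∷ c ∷ d ∷ []) [] []

rs₄-⊑-recQ : ∀ a b c d rest → proj₂ (rs₄ a b c d) ⊑ recQ (a ∷ b ∷ c ∷ d ∷ rest)
rs₄-⊑-recQ a b c d rest = ⊑-recQFrom 5 rest (proj₁ (rs₄ a b c d)) (proj₂ (rs₄ a b c d))

record Opening (a b c d : ℕ) : Set where
  field
    c<a : c < a
    c<d : c < d
    a<b : a < b
    d<b : d < b

firstRow₃≥5 : ∀ {m j} → j < 5 → Prefix _≡_ (1 ∷ 2 ∷ j ∷ []) (1 ∷ 2 ∷ map (5 +_) (upTo m)) → ⊥
firstRow₃≥5 {zero} j<5 (_ ∷ _ ∷ ())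
firstRow₃≥5 {suc m} j<5 (_ ∷ _ ∷ j≡5 ∷ _) = <-irrefl j≡5 j<5

module _ {m : ℕ} where

  2-in-row₂ : (1 ∷ []) ∷ (2 ∷ []) ∷ [] ⊑ Qhat (5 + m) → ⊥
  2-in-row₂ (_ ∷ (() ∷ _) ∷ _)

  3-in-row₁ : (1 ∷ 2 ∷ 3 ∷ []) ∷ [] ⊑ Qhat (5 + m) → ⊥
  3-in-row₁ (row₁ ∷ _) = firstRow₃≥5 (s≤s (s≤s (s≤s (s≤s z≤n)))) row₁

  4-in-row₁ : (1 ∷ 2 ∷ 4 ∷ []) ∷ (3 ∷ []) ∷ [] ⊑ Qhat (5 + m) → ⊥
  4-in-row₁ (row₁ ∷ _) = firstRow₃≥5 ≤-refl row₁

  4-in-row₃ : (1 ∷ 2 ∷ []) ∷ (3 ∷ []) ∷ (4 ∷ []) ∷ [] ⊑ Qhat (5 + m) → ⊥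
  4-in-row₃ (_ ∷ _ ∷ (() ∷ _) ∷ _)

opening : ∀ m a b c d → a ≢ b → c ≢ d → proj₂ (rs₄ a b c d) ⊑ Qhat (5 + m) → Opening a b c d
opening m a b c d a≢b c≢d Q₄⊑ with b <ᵇ a in b<ᵇa
... | true = ⊥-elim (2-in-row₂ (⊑.trans (⊑-recQFrom 3 (c ∷ d ∷ []) ((b ∷ []) ∷ (a ∷ []) ∷ []) _) Q₄⊑))
... | false with c <ᵇ a in c<ᵇa
...   | true with d <ᵇ c in d<ᵇc
...     | true rewrite c<ᵇa = ⊥-elim (4-in-row₃ Q₄⊑)  -- the bumped c meets a again
...     | false with d <ᵇ b in d<ᵇb
...       | false = ⊥-elim (4-in-row₁ Q₄⊑)
...       | true = record
  { c<a = <ᵇ-true⇒< c<ᵇa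
  ; c<d = ≤∧≢⇒< (<ᵇ-false⇒≥ d<ᵇc) c≢d
  ; a<b = ≤∧≢⇒< (<ᵇ-false⇒≥ b<ᵇa) a≢b
  ; d<b = <ᵇ-true⇒< d<ᵇb
  }
opening m a b c d a≢b c≢d Q₄⊑ | false | false with c <ᵇ b in c<ᵇb
...   | false = ⊥-elim (3-in-row₁ (⊑.trans (⊑-recQFrom 4 (d ∷ []) ((a ∷ b ∷ c ∷ []) ∷ []) _) Q₄⊑))
...   | true with d <ᵇ a
...     | true with a <ᵇ b in a<ᵇb
...       | true = ⊥-elim (4-in-row₃ Q₄⊑)
...       | false = ⊥-elim (a≢b (≤-antisym (<ᵇ-false⇒≥ b<ᵇa) (<ᵇ-false⇒≥ a<ᵇb)))
opening m a b c d a≢b c≢d Q₄⊑ | false | false | true | false with d <ᵇ c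
...       | false = ⊥-elim (4-in-row₁ Q₄⊑)
...       | true rewrite c<ᵇb = ⊥-elim (4-in-row₃ Q₄⊑)

opening-state : ∀ {a b c d} → Opening a b c d →
  rs₄ a b c d ≡ ((c ∷ d ∷ []) ∷ (a ∷ b ∷ []) ∷ [] , (1 ∷ 2 ∷ []) ∷ (3 ∷ 4 ∷ []) ∷ [])
opening-state record { c<a = c<a ; c<d = c<d ; a<b = a<b ; d<b = d<b }
  rewrite <ᵇ-false (<⇒≤ a<b) | <ᵇ-true c<a | <ᵇ-false (<⇒≤ c<d) | <ᵇ-true d<b | <ᵇ-false (<⇒≤ a<b) = refl

recQ-after-opening : ∀ {a b c d} rest → Opening a b c d →
  recQ (a ∷ b ∷ c ∷ d ∷ rest) ≡ recQFrom 5 rest ((c ∷ d ∷ []) ∷ (a ∷ b ∷ []) ∷ []) ((1 ∷ 2 ∷ []) ∷ (3 ∷ 4 ∷ []) ∷ [])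
recQ-after-opening rest o = cong (λ (P , Q) → recQFrom 5 rest P Q) (opening-state o)

Placement : ℕ → ℕ → ℕ → ℕ → ℕ → Set
Placement a c d z v = v ≡ c ⊎ v ≡ d ⊎ v ≡ a ⊎ v ≡ z ⊎ d < v

placement : ∀ {a b c d} rest → Opening a b c d → All (d ≢_) rest →
  recQ (a ∷ b ∷ c ∷ d ∷ rest) ≡ Qhat (4 + length rest) →
  ∀ {v} → v ∈ a ∷ b ∷ c ∷ d ∷ rest → Placement a c d (rest at length rest) v
placement rest o d∉rest hq (here refl) = inj₂ (inj₂ (inj₁ refl))
placement rest o d∉rest hq (there (here refl)) = inj₂ (inj₂ (inj₂ (inj₂ (Opening.d<b o))))
placement rest o d∉rest hq (there (there (here refl))) = inj₁ refl
placement rest o d∉rest hq (there (there (there (here refl)))) = inj₂ (inj₁ refl)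
placement rest o d∉rest hq (there (there (there (there v∈rest))))
  with tail-above-firstRow 5 rest _ _ _ (there (here refl)) refl
         (trans (sym (recQ-after-opening rest o)) hq) v∈rest
... | inj₁ d≤v = inj₂ (inj₂ (inj₂ (inj₂ (≤∧≢⇒< d≤v (All.lookup d∉rest v∈rest)))))
... | inj₂ v≡z = inj₂ (inj₂ (inj₂ (inj₁ v≡z)))

placement-1 : ∀ {a c d z} → 1 ≤ c → c < a → c < d → Placement a c d z 1 → z ≡ 1 ⊎ c ≡ 1
placement-1 1≤c c<a c<d (inj₁ 1≡c) = inj₂ (sym 1≡c)
placement-1 1≤c c<a c<d (inj₂ (inj₁ refl)) = ⊥-elim (<⇒≱ c<d 1≤c)
placement-1 1≤c c<a c<d (inj₂ (inj₂ (inj₁ refl))) = ⊥-elim (<⇒≱ c<a 1≤c)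
placement-1 1≤c c<a c<d (inj₂ (inj₂ (inj₂ (inj₁ 1≡z)))) = inj₁ (sym 1≡z)
placement-1 1≤c c<a c<d (inj₂ (inj₂ (inj₂ (inj₂ d<1)))) = ⊥-elim (<⇒≱ (<-trans c<d d<1) 1≤c)

placement-2 : ∀ {a c d z} → c ≡ 1 → c < d → Placement a c d z 2 → a ≡ 2 ⊎ d ≡ 2 ⊎ z ≡ 2
placement-2 refl c<d (inj₁ ())
placement-2 refl c<d (inj₂ (inj₁ 2≡d)) = inj₂ (inj₁ (sym 2≡d))
placement-2 refl c<d (inj₂ (inj₂ (inj₁ 2≡a))) = inj₁ (sym 2≡a)
placement-2 refl c<d (inj₂ (inj₂ (inj₂ (inj₁ 2≡z)))) = inj₂ (inj₂ (sym 2≡z))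
placement-2 refl c<d (inj₂ (inj₂ (inj₂ (inj₂ d<2)))) = ⊥-elim (<⇒≱ d<2 c<d)

placement-3 : ∀ {a c d z} → c ≡ 1 → a ≡ 2 → c < d → a ≢ d → Placement a c d z 3 → d ≡ 3 ⊎ z ≡ 3
placement-3 refl refl c<d a≢d (inj₁ ())
placement-3 refl refl c<d a≢d (inj₂ (inj₁ 3≡d)) = inj₁ (sym 3≡d)
placement-3 refl refl c<d a≢d (inj₂ (inj₂ (inj₁ ())))
placement-3 refl refl c<d a≢d (inj₂ (inj₂ (inj₂ (inj₁ 3≡z)))) = inj₂ (sym 3≡z)
placement-3 refl refl c<d a≢d (inj₂ (inj₂ (inj₂ (inj₂ d<3)))) = ⊥-elim (a≢d (≤-antisym c<d (≤-pred d<3)))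

lemma6p6 : (n : ℕ) → 5 ≤ n → (w : List ℕ) → IsPerm n w → recQ w ≡ Qhat n →
    ((w at n ≡ 1) ⊎ (w at 3 ≡ 1))
    × (w at 3 ≡ 1 → (w at 1 ≡ 2) ⊎ ((w at 4 ≡ 2) ⊎ (w at n ≡ 2)))
    × (w at 3 ≡ 1 → w at 1 ≡ 2 → (w at 4 ≡ 3) ⊎ (w at n ≡ 3))
lemma6p6 n 5≤n w perm hq with refl ← IsPerm-length perm | w | 5≤n
... | [] | ()
... | _ ∷ [] | s≤s ()
... | _ ∷ _ ∷ [] | s≤s (s≤s ())
... | _ ∷ _ ∷ _ ∷ [] | s≤s (s≤s (s≤s ()))
... | _ ∷ _ ∷ _ ∷ _ ∷ [] | s≤s (s≤s (s≤s (s≤s ())))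
... | a ∷ b ∷ c ∷ d ∷ e ∷ rest | _ with IsPerm-unique perm
...   | (a≢b ∷ _ ∷ a≢d ∷ _) ∷ _ ∷ (c≢d ∷ _) ∷ d∉rest ∷ _ =
  placement-1 (IsPerm-positive perm (there (there (here refl)))) c<a c<d (place (IsPerm-∋ perm z<s))
  , (λ c≡1 → placement-2 c≡1 c<d (place (IsPerm-∋ perm (s<s z<s))))
  , (λ c≡1 a≡2 → placement-3 c≡1 a≡2 c<d a≢d (place (IsPerm-∋ perm (s<s (s<s z<s)))))
  where
  o : Opening a b c d
  o = opening (length rest) a b c d a≢b c≢d (subst (proj₂ (rs₄ a b c d) ⊑_) hq (rs₄-⊑-recQ a b c d (e ∷ rest)))
  open Opening o
  place : ∀ {v} → v ∈ a ∷ b ∷ c ∷ d ∷ e ∷ rest → Placement a c d ((e ∷ rest) at length (e ∷ rest)) v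
  place = placement (e ∷ rest) o d∉rest hq
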